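{- Let $m,k$ be positive integers, $N=m^2k$, let $\ell$ be a prime not dividing $2k$, and let $w\ge1$. Then \[ \frac{T(\ell^w)}{\ell^{w-1}}=-\left(\frac{m(N-1)}{\ell}\right)^2+\begin{cases}\ell-1-\left(\frac k\ell\right)&\text{if }w\text{ is even},\\ -1&\text{if }w\text{ is odd}.\end{cases} \]
   Context: For $n\in\mathbb N$, $T(n)=\sum_{d\bmod n}\left(\frac{d-4k}{n}\right)\#\{j\bmod n:\ j^2\equiv d\pmod n,\ (N+1+jm,n)=1\}$, where $\left(\frac{\cdot}{n}\right)$ is the Jacobi/Kronecker symbol (for $n=\ell^w$ it equals $\left(\frac{\cdot}{\ell}\right)^w$), and $\left(\frac{a}{\ell}\right)^2$ equals $1$ if $\ell\nmid a$ and $0$ otherwise. -}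

module Defs where

open import Data.Nat as ℕ using (ℕ; zero; suc)
open import Data.Nat.Divisibility using (_∣?_)
open import Data.Nat.GCD using (gcd)
open import Data.Integer as ℤ using (ℤ; +_; ∣_∣)
open import Data.List using (List; []; _∷_; upTo; filter; length; map)
open import Data.Bool.ListAction using (any)
open import Data.Bool using (Bool; true; false; if_then_else_)
open import Relation.Nullary.Decidable using (⌊_⌋; _×-dec_)
open import Data.Nat using (_≟_)

divℤ : ℕ → ℤ → Bool
divℤ p a = ⌊ p ∣? ∣ a ∣ ⌋

legendre : ℕ → ℤ → ℤ
legendre p a =
  if divℤ p a then + 0
  else (if any (λ x → divℤ p ((+ x) ℤ.* (+ x) ℤ.- a)) (upTo p)
        then + 1 else ℤ.- (+ 1))

-- Jacobi/Kronecker symbol (a / ℓ^w) = (a / ℓ)^w for prime ℓ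
jacobiPP : ℕ → ℕ → ℤ → ℤ
jacobiPP ℓ w a = legendre ℓ a ℤ.^ w

count : (n N m d : ℕ) → ℕ
count n N m d =
  length (filter (λ j → (n ∣? ∣ (+ (j ℕ.* j)) ℤ.- (+ d) ∣)
                        ×-dec (gcd (N ℕ.+ 1 ℕ.+ j ℕ.* m) n ≟ 1))
                 (upTo n))

sumℤ : List ℤ → ℤ
sumℤ [] = + 0
sumℤ (x ∷ xs) = x ℤ.+ sumℤ xs

T : (ℓ w m k : ℕ) → ℤ
T ℓ w m k =
  let n = ℓ ℕ.^ w ; N = m ℕ.* m ℕ.* k in
  sumℤ (map (λ d → jacobiPP ℓ w ((+ d) ℤ.- (+ (4 ℕ.* k))) ℤ.* (+ count n N m d))
            (upTo n))

module Submission where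

-- Summing over d first collapses T(ℓ^w) to the sum over j mod ℓ^w of χ(j² − 4k)^w · [ℓ ∤ N + 1 + jm],
-- χ the Legendre symbol mod ℓ; the summand has period ℓ in j, which produces the factor ℓ^(w−1).
-- If ℓ ∣ N + 1 + jm then ℓ ∤ m and m²(j² − 4k) ≡ (N − 1)², so every excluded j contributes
-- χ(m(N − 1))²; there is exactly one excluded j mod ℓ when ℓ ∤ m, and none contributes when ℓ ∣ m.
-- For even w the full sum of χ(j² − 4k)² is ℓ minus the number of square roots of 4k, i.e.
-- ℓ − 1 − χ(k).  For odd w it is −1: χ(j² − a) + 1 counts the y with y² ≡ j² − a, and the substitution
-- y = j + u turns this count into linear congruences 2u·j + u² + a ≡ 0, exactly one for each u ≢ 0.

open import Defs
open import Data.Nat as ℕ using (ℕ; zero; suc; z≤n; s≤s; _≥_; _∸_)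
import Data.Nat.Properties as ℕP
open import Data.Nat.Divisibility as ℕD using (_∣_; _∣?_; divides)
open import Data.Nat.Primality using (Prime; prime⇒nonZero; prime⇒irreducible; euclidsLemma; ¬prime[1])
open import Data.Nat.Coprimality using (Coprime; coprime-Bézout; coprime-divisor; coprime⇒gcd≡1)
open import Data.Nat.GCD using (gcd; gcd-greatest; module Bézout)
open import Data.Integer as ℤ using (ℤ; +_; -[1+_]; ∣_∣; _+_; _-_; _*_; -_; _^_)
import Data.Integer.Properties as ℤP
open import Data.Integer.Divisibility.Signed as ℤD using (∣ᵤ⇒∣; ∣⇒∣ᵤ)
  renaming (_∣_ to _∣ℤ_; _∣?_ to _∣ℤ?_)
open import Data.Integer.DivMod using (_%ℕ_; _/ℕ_; a≡a%ℕn+[a/ℕn]*n; n%ℕd<d)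
open import Data.Integer.Tactic.RingSolver using (solve-∀)
open import Data.List using (upTo; applyUpTo; filter; length; map)
open import Data.List.Membership.Propositional using (find; lose)
open import Data.List.Membership.Propositional.Properties using (∈-upTo⁺)
open import Data.List.Relation.Unary.Any.Properties using (any⁺; any⁻)
open import Data.Bool using (Bool; true; false) renaming (T to IsTrue)
open import Data.Bool.ListAction using (any)
open import Data.Product using (_×_; _,_; Σ-syntax)
open import Data.Sum using (_⊎_; inj₁; inj₂; [_,_]′) renaming (map to map-⊎)
open import Relation.Nullary using (¬_; Dec; yes; no; ¬?)
open import Relation.Nullary.Decidable using (_×-dec_; toWitness; fromWitness)
open import Relation.Binary.PropositionalEquality
  using (_≡_; _≢_; refl; sym; trans; cong; cong₂; subst; module ≡-Reasoning)
open import Function using (_∘_; id; _⇔_; mk⇔; Equivalence)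
open import Data.Empty using (⊥-elim)

∑< : ℕ → (ℕ → ℤ) → ℤ
∑< zero    f = + 0
∑< (suc n) f = f 0 + ∑< n (f ∘ suc)

syntax ∑< n (λ i → e) = ∑[ i < n ] e

sumℤ-map-applyUpTo : ∀ (f : ℕ → ℤ) g n → sumℤ (map f (applyUpTo g n)) ≡ ∑< n (f ∘ g)
sumℤ-map-applyUpTo f g zero    = refl
sumℤ-map-applyUpTo f g (suc n) = cong (_+_ (f (g 0))) (sumℤ-map-applyUpTo f (g ∘ suc) n)

∑-cong : ∀ n (f g : ℕ → ℤ) → (∀ i → i ℕ.< n → f i ≡ g i) → ∑< n f ≡ ∑< n g
∑-cong zero    f g f≗g = refl
∑-cong (suc n) f g f≗g =
  cong₂ _+_ (f≗g 0 (s≤s z≤n)) (∑-cong n (f ∘ suc) (g ∘ suc) (λ i i<n → f≗g (suc i) (s≤s i<n)))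

∑-zero : ∀ n (f : ℕ → ℤ) → (∀ i → i ℕ.< n → f i ≡ + 0) → ∑< n f ≡ + 0
∑-zero zero    f f≗0 = refl
∑-zero (suc n) f f≗0 =
  cong₂ _+_ (f≗0 0 (s≤s z≤n)) (∑-zero n (f ∘ suc) (λ i i<n → f≗0 (suc i) (s≤s i<n)))

∑-single : ∀ n a (f : ℕ → ℤ) → a ℕ.< n → (∀ i → i ℕ.< n → i ≢ a → f i ≡ + 0) → ∑< n f ≡ f a
∑-single (suc n) zero f _ f≗0 =
  trans (cong (_+_ (f 0)) (∑-zero n (f ∘ suc) (λ i i<n → f≗0 (suc i) (s≤s i<n) λ ())))
        (ℤP.+-identityʳ (f 0))
∑-single (suc n) (suc a) f (s≤s a<n) f≗0 =
  trans (cong₂ _+_ (f≗0 0 (s≤s z≤n) λ ())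
                     (∑-single n a (f ∘ suc) a<n λ i i<n i≢a → f≗0 (suc i) (s≤s i<n) (i≢a ∘ ℕP.suc-injective)))
        (ℤP.+-identityˡ (f (suc a)))

∑-pair : ∀ n a b (f : ℕ → ℤ) → a ℕ.< n → b ℕ.< n → a ≢ b →
         (∀ i → i ℕ.< n → i ≢ a → i ≢ b → f i ≡ + 0) → ∑< n f ≡ f a + f b
∑-pair (suc n) zero zero f _ _ a≢b _ = ⊥-elim (a≢b refl)
∑-pair (suc n) zero (suc b) f _ (s≤s b<n) _ f≗0 =
  cong (_+_ (f 0)) (∑-single n b (f ∘ suc) b<n
    λ i i<n i≢b → f≗0 (suc i) (s≤s i<n) (λ ()) (i≢b ∘ ℕP.suc-injective))
∑-pair (suc n) (suc a) zero f (s≤s a<n) _ _ f≗0 =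
  trans (cong (_+_ (f 0)) (∑-single n a (f ∘ suc) a<n
          λ i i<n i≢a → f≗0 (suc i) (s≤s i<n) (i≢a ∘ ℕP.suc-injective) (λ ())))
        (ℤP.+-comm (f 0) (f (suc a)))
∑-pair (suc n) (suc a) (suc b) f (s≤s a<n) (s≤s b<n) a≢b f≗0 =
  trans (cong₂ _+_ (f≗0 0 (s≤s z≤n) (λ ()) (λ ()))
                     (∑-pair n a b (f ∘ suc) a<n b<n (a≢b ∘ cong suc)
                       λ i i<n i≢a i≢b → f≗0 (suc i) (s≤s i<n) (i≢a ∘ ℕP.suc-injective) (i≢b ∘ ℕP.suc-injective)))
        (ℤP.+-identityˡ _)

∑-+ : ∀ n (f g : ℕ → ℤ) → ∑[ i < n ] (f i + g i) ≡ ∑< n f + ∑< n g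
∑-+ zero    f g = refl
∑-+ (suc n) f g rewrite ∑-+ n (f ∘ suc) (g ∘ suc) =
  interchange (f 0) (g 0) (∑< n (f ∘ suc)) (∑< n (g ∘ suc))
  where interchange : ∀ a b c d → a + b + (c + d) ≡ a + c + (b + d)
        interchange = solve-∀

∑-*ˡ : ∀ n c (f : ℕ → ℤ) → ∑[ i < n ] (c * f i) ≡ c * ∑< n f
∑-*ˡ zero    c f = sym (ℤP.*-zeroʳ c)
∑-*ˡ (suc n) c f rewrite ∑-*ˡ n c (f ∘ suc) = sym (ℤP.*-distribˡ-+ c (f 0) _)

∑-neg : ∀ n (f : ℕ → ℤ) → ∑[ i < n ] (- f i) ≡ - ∑< n f
∑-neg n f = begin
  ∑[ i < n ] (- f i)        ≡⟨ ∑-cong n _ _ (λ i _ → sym (ℤP.-1*i≡-i (f i))) ⟩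
  ∑[ i < n ] (- + 1 * f i)  ≡⟨ ∑-*ˡ n (- + 1) f ⟩
  - + 1 * ∑< n f            ≡⟨ ℤP.-1*i≡-i _ ⟩
  - ∑< n f                  ∎
  where open ≡-Reasoning

∑-const : ∀ n c → ∑[ i < n ] c ≡ + n * c
∑-const zero    c = sym (ℤP.*-zeroˡ c)
∑-const (suc n) c rewrite ∑-const n c = sym (ℤP.suc-* (+ n) c)

∑-swap : ∀ n m (f : ℕ → ℕ → ℤ) → ∑[ i < n ] ∑[ j < m ] f i j ≡ ∑[ j < m ] ∑[ i < n ] f i j
∑-swap zero    m f = sym (∑-zero m _ (λ _ _ → refl))
∑-swap (suc n) m f rewrite ∑-swap n m (f ∘ suc) = sym (∑-+ m (f 0) (λ j → ∑[ i < n ] f (suc i) j))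

∑-++ : ∀ a b (f : ℕ → ℤ) → ∑< (a ℕ.+ b) f ≡ ∑< a f + ∑[ i < b ] f (a ℕ.+ i)
∑-++ zero    b f = sym (ℤP.+-identityˡ _)
∑-++ (suc a) b f rewrite ∑-++ a b (f ∘ suc) = sym (ℤP.+-assoc (f 0) _ _)

∑-snoc : ∀ n (f : ℕ → ℤ) → ∑< (suc n) f ≡ ∑< n f + f n
∑-snoc zero    f = trans (ℤP.+-identityʳ (f 0)) (sym (ℤP.+-identityˡ (f 0)))
∑-snoc (suc n) f rewrite ∑-snoc n (f ∘ suc) = sym (ℤP.+-assoc (f 0) _ _)

∑-head : ∀ n .{{_ : ℕ.NonZero n}} (f : ℕ → ℤ) → ∑< n f ≡ f 0 + ∑[ i < ℕ.pred n ] f (suc i)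
∑-head (suc n) f = refl

Periodic : ℕ → (ℕ → ℤ) → Set
Periodic p f = ∀ i → f (p ℕ.+ i) ≡ f i

∑-periodic : ∀ q p (f : ℕ → ℤ) → Periodic p f → ∑< (q ℕ.* p) f ≡ + q * ∑< p f
∑-periodic zero    p f per = sym (ℤP.*-zeroˡ (∑< p f))
∑-periodic (suc q) p f per = begin
  ∑< (p ℕ.+ q ℕ.* p) f                   ≡⟨ ∑-++ p (q ℕ.* p) f ⟩
  ∑< p f + ∑[ i < q ℕ.* p ] f (p ℕ.+ i)  ≡⟨ cong (_+_ (∑< p f)) (∑-cong (q ℕ.* p) _ _ (λ i _ → per i)) ⟩
  ∑< p f + ∑< (q ℕ.* p) f                ≡⟨ cong (_+_ (∑< p f)) (∑-periodic q p f per) ⟩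
  ∑< p f + + q * ∑< p f                  ≡⟨ sym (ℤP.suc-* (+ q) (∑< p f)) ⟩
  + suc q * ∑< p f                       ∎
  where open ≡-Reasoning

∑-rotate : ∀ p (f : ℕ → ℤ) → Periodic p f → ∀ c → ∑[ i < p ] f (c ℕ.+ i) ≡ ∑< p f
∑-rotate zero    f per c       = refl
∑-rotate (suc p) f per zero    = refl
∑-rotate (suc p) f per (suc c) = trans rotate-once (∑-rotate (suc p) f per c)
  where
  open ≡-Reasoning
  g : ℕ → ℤ
  g i = f (suc c ℕ.+ i)
  wrap : g p ≡ f (c ℕ.+ 0)
  wrap = begin
    f (suc c ℕ.+ p)  ≡⟨ cong f (trans (sym (ℕP.+-suc c p)) (ℕP.+-comm c (suc p))) ⟩
    f (suc p ℕ.+ c)  ≡⟨ per c ⟩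
    f c              ≡⟨ cong f (sym (ℕP.+-identityʳ c)) ⟩
    f (c ℕ.+ 0)      ∎
  rotate-once : ∑< (suc p) g ≡ ∑[ i < suc p ] f (c ℕ.+ i)
  rotate-once = begin
    ∑< (suc p) g                ≡⟨ ∑-snoc p g ⟩
    ∑< p g + g p                ≡⟨ ℤP.+-comm (∑< p g) (g p) ⟩
    g p + ∑< p g                ≡⟨ cong₂ _+_ wrap (∑-cong p _ _ (λ i _ → cong f (sym (ℕP.+-suc c i)))) ⟩
    ∑[ i < suc p ] f (c ℕ.+ i)  ∎

𝟙 : ∀ {p} {P : Set p} → Dec P → ℤ
𝟙 (yes _) = + 1
𝟙 (no _)  = + 0

𝟙-yes : ∀ {p} {P : Set p} → P → (P? : Dec P) → 𝟙 P? ≡ + 1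
𝟙-yes p (yes _) = refl
𝟙-yes p (no ¬p) = ⊥-elim (¬p p)

𝟙-no : ∀ {p} {P : Set p} → ¬ P → (P? : Dec P) → 𝟙 P? ≡ + 0
𝟙-no ¬p (yes p) = ⊥-elim (¬p p)
𝟙-no ¬p (no _)  = refl

𝟙-⇔ : ∀ {p q} {P : Set p} {Q : Set q} (P? : Dec P) (Q? : Dec Q) → (P → Q) → (Q → P) → 𝟙 P? ≡ 𝟙 Q?
𝟙-⇔ P? (yes q) P→Q Q→P = 𝟙-yes (Q→P q) P?
𝟙-⇔ P? (no ¬q) P→Q Q→P = 𝟙-no (¬q ∘ P→Q) P?

𝟙-× : ∀ {p q} {P : Set p} {Q : Set q} (P? : Dec P) (Q? : Dec Q) → 𝟙 (P? ×-dec Q?) ≡ 𝟙 P? * 𝟙 Q?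
𝟙-× (yes _) (yes _) = refl
𝟙-× (yes _) (no _)  = refl
𝟙-× (no _)  (yes _) = refl
𝟙-× (no _)  (no _)  = refl

𝟙-complement-idempotent : ∀ {p} {P : Set p} (P? : Dec P) → (+ 1 - 𝟙 P?) * (+ 1 - 𝟙 P?) ≡ + 1 - 𝟙 P?
𝟙-complement-idempotent (yes _) = refl
𝟙-complement-idempotent (no _)  = refl

𝟙-¬ : ∀ {p} {P : Set p} (P? : Dec P) → 𝟙 (¬? P?) ≡ + 1 - 𝟙 P?
𝟙-¬ (yes _) = refl
𝟙-¬ (no _)  = refl

*-𝟙-cong : ∀ {p} {P : Set p} (P? : Dec P) {x y} → (P → x ≡ y) → x * 𝟙 P? ≡ y * 𝟙 P?
*-𝟙-cong (yes p) x≡y = cong (_* + 1) (x≡y p)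
*-𝟙-cong (no _) {x} {y} _ = trans (ℤP.*-zeroʳ x) (sym (ℤP.*-zeroʳ y))

length-filter : ∀ {p} {P : ℕ → Set p} (P? : ∀ x → Dec (P x)) g n →
                + length (filter P? (applyUpTo g n)) ≡ ∑[ i < n ] 𝟙 (P? (g i))
length-filter P? g zero = refl
length-filter P? g (suc n) with P? (g 0)
... | yes _ = trans (ℤP.pos-+ 1 _) (cong (_+_ (+ 1)) (length-filter P? (g ∘ suc) n))
... | no _  = trans (length-filter P? (g ∘ suc) n) (sym (ℤP.+-identityˡ _))

infix 4 _≡_mod_
_≡_mod_ : ℤ → ℤ → ℕ → Set
_≡_mod_ a b n = + n ∣ℤ a - b

≡mod-sym : ∀ {n} a b → a ≡ b mod n → b ≡ a mod n
≡mod-sym a b a≡b = subst (_ ∣ℤ_) (negate-difference a b) (ℤD.∣m⇒∣-m a≡b)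
  where negate-difference : ∀ a b → - (a - b) ≡ b - a
        negate-difference = solve-∀

∣-resp-≡mod : ∀ {n a b} → a ≡ b mod n → + n ∣ℤ b → + n ∣ℤ a
∣-resp-≡mod {a = a} {b} a≡b n∣b = subst (_ ∣ℤ_) (cancel a b) (ℤD.∣m∣n⇒∣m+n a≡b n∣b)
  where cancel : ∀ a b → a - b + b ≡ a
        cancel = solve-∀

≡mod-trans : ∀ {n} a b c → a ≡ b mod n → b ≡ c mod n → a ≡ c mod n
≡mod-trans a b c a≡b b≡c = subst (_ ∣ℤ_) (telescope a b c) (ℤD.∣m∣n⇒∣m+n a≡b b≡c)
  where telescope : ∀ a b c → a - b + (b - c) ≡ a - c
        telescope = solve-∀

∣∧<⇒≡0 : ∀ {n d} → n ∣ d → d ℕ.< n → d ≡ 0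
∣∧<⇒≡0 {d = zero}  _   _   = refl
∣∧<⇒≡0 {d = suc d} n∣d d<n = ⊥-elim (ℕP.<⇒≱ d<n (ℕD.∣⇒≤ n∣d))

≤∧≡mod⇒≡ : ∀ {n x y} → x ℕ.≤ y → y ℕ.< n → + y ≡ + x mod n → x ≡ y
≤∧≡mod⇒≡ {n} {x} {y} x≤y y<n y≡x =
  ℕP.≤-antisym x≤y (ℕP.m∸n≡0⇒m≤n (∣∧<⇒≡0 n∣y∸x (ℕP.≤-<-trans (ℕP.m∸n≤m y x) y<n)))
  where
  ∣y-x∣≡y∸x : ∣ + y - + x ∣ ≡ y ∸ x
  ∣y-x∣≡y∸x = trans (cong ∣_∣ (ℤP.m-n≡m⊖n y x)) (trans (ℤP.∣m⊖n∣≡∣n⊖m∣ y x) (ℤP.∣⊖∣-≤ x≤y))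
  n∣y∸x : n ∣ y ∸ x
  n∣y∸x = subst (n ∣_) ∣y-x∣≡y∸x (∣⇒∣ᵤ y≡x)

≡mod⇒≡ : ∀ {n x y} → x ℕ.< n → y ℕ.< n → + x ≡ + y mod n → x ≡ y
≡mod⇒≡ {x = x} {y} x<n y<n x≡y with ℕP.≤-total x y
... | inj₁ x≤y = ≤∧≡mod⇒≡ x≤y y<n (≡mod-sym (+ x) (+ y) x≡y)
... | inj₂ y≤x = sym (≤∧≡mod⇒≡ y≤x x<n x≡y)

≡mod-representative : ∀ n .{{_ : ℕ.NonZero n}} z → Σ[ r ∈ ℕ ] (r ℕ.< n × + r ≡ z mod n)
≡mod-representative n z =
  z %ℕ n , n%ℕd<d z n , ℤD.divides (- (z /ℕ n)) (remainder-eq {+ (z %ℕ n)} {z /ℕ n} (a≡a%ℕn+[a/ℕn]*n z n))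
  where
  remainder-eq : ∀ {r q z} → z ≡ r + q * + n → r - z ≡ - q * + n
  remainder-eq {r} {q} refl = cancel r q (+ n)
    where cancel : ∀ r q m → r - (r + q * m) ≡ - q * m
          cancel = solve-∀

∑-select-mod : ∀ n .{{_ : ℕ.NonZero n}} (f : ℤ → ℤ) → (∀ a b → a ≡ b mod n → f a ≡ f b) →
               ∀ z → ∑[ d < n ] (f (+ d) * 𝟙 (n ∣? ∣ z - + d ∣)) ≡ f z
∑-select-mod n f f-resp z with ≡mod-representative n z
... | r , r<n , r≡z = begin
  ∑[ d < n ] (f (+ d) * 𝟙 (n ∣? ∣ z - + d ∣))  ≡⟨ ∑-single n r _ r<n others ⟩
  f (+ r) * 𝟙 (n ∣? ∣ z - + r ∣)               ≡⟨ cong (f (+ r) *_) (𝟙-yes (∣⇒∣ᵤ z≡r) (n ∣? ∣ z - + r ∣)) ⟩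
  f (+ r) * + 1                                ≡⟨ ℤP.*-identityʳ (f (+ r)) ⟩
  f (+ r)                                      ≡⟨ f-resp (+ r) z r≡z ⟩
  f z                                          ∎
  where
  open ≡-Reasoning
  z≡r : z ≡ + r mod n
  z≡r = ≡mod-sym (+ r) z r≡z
  others : ∀ d → d ℕ.< n → d ≢ r → f (+ d) * 𝟙 (n ∣? ∣ z - + d ∣) ≡ + 0
  others d d<n d≢r =
    trans (cong (f (+ d) *_) (𝟙-no (d≢r ∘ d≡r ∘ ∣ᵤ⇒∣) (n ∣? ∣ z - + d ∣))) (ℤP.*-zeroʳ (f (+ d)))
    where d≡r : z ≡ + d mod n → d ≡ r
          d≡r z≡d = ≡mod⇒≡ d<n r<n (≡mod-trans (+ d) z (+ r) (≡mod-sym z (+ d) z≡d) z≡r)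

^-idempotent : ∀ {y} → y * y ≡ y → ∀ n → y ^ suc n ≡ y
^-idempotent {y} yy≡y zero    = ℤP.*-identityʳ y
^-idempotent {y} yy≡y (suc n) = trans (cong (y *_) (^-idempotent yy≡y n)) yy≡y

^-odd-of-cube : ∀ {y} → y * y * y ≡ y → ∀ q → y ^ suc (q ℕ.* 2) ≡ y
^-odd-of-cube {y} yyy≡y zero    = ℤP.*-identityʳ y
^-odd-of-cube {y} yyy≡y (suc q) =
  trans (cong (λ z → y * (y * z)) (^-odd-of-cube yyy≡y q)) (trans (sym (ℤP.*-assoc y y y)) yyy≡y)

^-even-of-cube : ∀ {y} → y * y * y ≡ y → ∀ q → y ^ (suc q ℕ.* 2) ≡ y * y
^-even-of-cube {y} yyy≡y zero    = cong (y *_) (ℤP.*-identityʳ y)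
^-even-of-cube {y} yyy≡y (suc q) =
  trans (cong (λ z → y * (y * z)) (^-even-of-cube yyy≡y q)) (trans (reassociate y) (cong (_* y) yyy≡y))
  where reassociate : ∀ y → y * (y * (y * y)) ≡ y * y * y * y
        reassociate = solve-∀

odd⇒suc-*2 : ∀ w → ¬ 2 ∣ w → Σ[ q ∈ ℕ ] w ≡ suc (q ℕ.* 2)
odd⇒suc-*2 zero          2∤w = ⊥-elim (2∤w (divides 0 refl))
odd⇒suc-*2 (suc zero)    2∤w = 0 , refl
odd⇒suc-*2 (suc (suc w)) 2∤w with odd⇒suc-*2 w (λ (divides q w≡2q) → 2∤w (divides (suc q) (cong (suc ∘ suc) w≡2q)))
... | q , w≡1+2q = suc q , cong (suc ∘ suc) w≡1+2q

module OddPrime {ℓ : ℕ} (ℓ-prime : Prime ℓ) (ℓ∤2 : ¬ ℓ ∣ 2) where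

  instance
    ℓ-nonZero : ℕ.NonZero ℓ
    ℓ-nonZero = prime⇒nonZero ℓ-prime

  ℓ∣m*n⇒ℓ∣m⊎ℓ∣n : ∀ a b → + ℓ ∣ℤ a * b → + ℓ ∣ℤ a ⊎ + ℓ ∣ℤ b
  ℓ∣m*n⇒ℓ∣m⊎ℓ∣n a b ℓ∣ab =
    map-⊎ ∣ᵤ⇒∣ ∣ᵤ⇒∣ (euclidsLemma ∣ a ∣ ∣ b ∣ ℓ-prime (subst (ℓ ∣_) (ℤP.abs-* a b) (∣⇒∣ᵤ ℓ∣ab)))

  ℓ∤m*n : ∀ {a b} → ¬ + ℓ ∣ℤ a → ¬ + ℓ ∣ℤ b → ¬ + ℓ ∣ℤ a * b
  ℓ∤m*n {a} {b} ℓ∤a ℓ∤b ℓ∣ab = [ ℓ∤a , ℓ∤b ]′ (ℓ∣m*n⇒ℓ∣m⊎ℓ∣n a b ℓ∣ab)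

  ℓ∣m*m⇒ℓ∣m : ∀ a → + ℓ ∣ℤ a * a → + ℓ ∣ℤ a
  ℓ∣m*m⇒ℓ∣m a ℓ∣aa = [ id , id ]′ (ℓ∣m*n⇒ℓ∣m⊎ℓ∣n a a ℓ∣aa)

  ℓ∤1 : ¬ + ℓ ∣ℤ + 1
  ℓ∤1 ℓ∣1 = ¬prime[1] (subst Prime (ℕD.∣1⇒≡1 (∣⇒∣ᵤ ℓ∣1)) ℓ-prime)

  ℓ∤+2 : ¬ + ℓ ∣ℤ + 2
  ℓ∤+2 = ℓ∤2 ∘ ∣⇒∣ᵤ

  ℓ∤nonzero : ∀ {x} → x ℕ.< ℓ → x ≢ 0 → ¬ + ℓ ∣ℤ + x
  ℓ∤nonzero {x} x<ℓ x≢0 ℓ∣x =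
    x≢0 (≡mod⇒≡ x<ℓ (ℕ.>-nonZero⁻¹ ℓ) (subst (+ ℓ ∣ℤ_) (sym (ℤP.+-identityʳ (+ x))) ℓ∣x))

  ℓ∤⇒coprime : ∀ {n} → ¬ + ℓ ∣ℤ + n → Coprime n ℓ
  ℓ∤⇒coprime ℓ∤n (d∣n , d∣ℓ) with prime⇒irreducible ℓ-prime d∣ℓ
  ... | inj₁ d≡1 = d≡1
  ... | inj₂ refl = ⊥-elim (ℓ∤n (∣ᵤ⇒∣ d∣n))

  inverse-ℕ : ∀ n → ¬ + ℓ ∣ℤ + n → Σ[ s ∈ ℤ ] s * + n ≡ + 1 mod ℓ
  inverse-ℕ n ℓ∤n with coprime-Bézout (ℓ∤⇒coprime ℓ∤n)
  ... | Bézout.+- x y 1+yℓ≡xn = + x , ℤD.divides (+ y) (shift (lift 1+yℓ≡xn))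
    where
    lift : suc (y ℕ.* ℓ) ≡ x ℕ.* n → + 1 + + y * + ℓ ≡ + x * + n
    lift eq = trans (cong (_+_ (+ 1)) (sym (ℤP.pos-* y ℓ))) (trans (cong +_ eq) (ℤP.pos-* x n))
    shift : ∀ {a b} → + 1 + b ≡ a → a - + 1 ≡ b
    shift {b = b} refl = cancel b
      where cancel : ∀ b → + 1 + b - + 1 ≡ b
            cancel = solve-∀
  ... | Bézout.-+ x y 1+xn≡yℓ = - + x , ℤD.divides (- + y) (shift (lift 1+xn≡yℓ))
    where
    lift : suc (x ℕ.* n) ≡ y ℕ.* ℓ → + 1 + + x * + n ≡ + y * + ℓ
    lift eq = trans (cong (_+_ (+ 1)) (sym (ℤP.pos-* x n))) (trans (cong +_ eq) (ℤP.pos-* y ℓ))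
    shift : + 1 + + x * + n ≡ + y * + ℓ → - + x * + n - + 1 ≡ - + y * + ℓ
    shift eq = trans (negate (+ x) (+ n)) (trans (cong -_ eq) (ℤP.neg-distribˡ-* (+ y) (+ ℓ)))
      where negate : ∀ a b → - a * b - + 1 ≡ - (+ 1 + a * b)
            negate = solve-∀

  inverse : ∀ c → ¬ + ℓ ∣ℤ c → Σ[ s ∈ ℤ ] s * c ≡ + 1 mod ℓ
  inverse (+ n)    ℓ∤c = inverse-ℕ n ℓ∤c
  inverse -[1+ n ] ℓ∤c with inverse-ℕ (suc n) (ℓ∤c ∘ ℤD.∣m⇒∣-m)
  ... | s , s*n≡1 = - s , subst (λ t → t ≡ + 1 mod ℓ) (sym (neg*neg s (+ suc n))) s*n≡1
    where neg*neg : ∀ a b → - a * - b ≡ a * b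
          neg*neg = solve-∀

  ≡mod-square : ∀ r z a → r ≡ z mod ℓ → z * z ≡ a mod ℓ → r * r ≡ a mod ℓ
  ≡mod-square r z a r≡z z²≡a =
    subst (+ ℓ ∣ℤ_) (difference-of-squares r z a) (ℤD.∣m∣n⇒∣m+n (ℤD.∣m⇒∣m*n (r + z) r≡z) z²≡a)
    where difference-of-squares : ∀ r z a → (r - z) * (r + z) + (z * z - a) ≡ r * r - a
          difference-of-squares = solve-∀

  χ : ℤ → ℤ
  χ = legendre ℓ

  IsSquare : ℤ → Set
  IsSquare a = Σ[ z ∈ ℤ ] z * z ≡ a mod ℓ

  is-square-at : ℤ → ℕ → Bool
  is-square-at a x = divℤ ℓ (+ x * + x - a)

  small-square-root : ∀ {a} → IsSquare a → Σ[ x ∈ ℕ ] (x ℕ.< ℓ × + x * + x ≡ a mod ℓ)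
  small-square-root {a} (z , z²≡a) with ≡mod-representative ℓ z
  ... | x , x<ℓ , x≡z = x , x<ℓ , ≡mod-square (+ x) z a x≡z z²≡a

  any-square-below-ℓ⇔IsSquare : ∀ a → IsTrue (any (is-square-at a) (upTo ℓ)) ⇔ IsSquare a
  any-square-below-ℓ⇔IsSquare a = mk⇔ to from
    where
    to : IsTrue (any (is-square-at a) (upTo ℓ)) → IsSquare a
    to t with find (any⁻ (is-square-at a) (upTo ℓ) t)
    ... | x , _ , x²≡a = + x , ∣ᵤ⇒∣ (toWitness x²≡a)
    from : IsSquare a → IsTrue (any (is-square-at a) (upTo ℓ))
    from □a with small-square-root □a
    ... | x , x<ℓ , x²≡a = any⁺ (is-square-at a) (lose (∈-upTo⁺ x<ℓ) (fromWitness (∣⇒∣ᵤ x²≡a)))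

  data LegendreView (a : ℤ) : ℤ → Set where
    divisible  : + ℓ ∣ℤ a → LegendreView a (+ 0)
    residue    : ¬ + ℓ ∣ℤ a → IsSquare a → LegendreView a (+ 1)
    nonresidue : ¬ + ℓ ∣ℤ a → ¬ IsSquare a → LegendreView a (- + 1)

  legendre-view : ∀ a → LegendreView a (χ a)
  legendre-view a with ℓ ∣? ∣ a ∣
  ... | yes ℓ∣a = divisible (∣ᵤ⇒∣ ℓ∣a)
  ... | no ℓ∤a with any (is-square-at a) (upTo ℓ) | any-square-below-ℓ⇔IsSquare a
  ...   | true  | squares = residue (ℓ∤a ∘ ∣⇒∣ᵤ) (Equivalence.to squares _)
  ...   | false | squares = nonresidue (ℓ∤a ∘ ∣⇒∣ᵤ) (Equivalence.from squares)

  legendre-resp-⇔ : ∀ {a b} → (+ ℓ ∣ℤ a ⇔ + ℓ ∣ℤ b) → (IsSquare a ⇔ IsSquare b) → χ a ≡ χ b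
  legendre-resp-⇔ {a} {b} ℓ∣⇔ square⇔ with χ a | legendre-view a | χ b | legendre-view b
  ... | _ | divisible _      | _ | divisible _      = refl
  ... | _ | divisible ℓ∣a    | _ | residue ℓ∤b _    = ⊥-elim (ℓ∤b (Equivalence.to ℓ∣⇔ ℓ∣a))
  ... | _ | divisible ℓ∣a    | _ | nonresidue ℓ∤b _ = ⊥-elim (ℓ∤b (Equivalence.to ℓ∣⇔ ℓ∣a))
  ... | _ | residue ℓ∤a _    | _ | divisible ℓ∣b    = ⊥-elim (ℓ∤a (Equivalence.from ℓ∣⇔ ℓ∣b))
  ... | _ | residue _ _      | _ | residue _ _      = refl
  ... | _ | residue _ □a     | _ | nonresidue _ ¬□b = ⊥-elim (¬□b (Equivalence.to square⇔ □a))
  ... | _ | nonresidue ℓ∤a _ | _ | divisible ℓ∣b    = ⊥-elim (ℓ∤a (Equivalence.from ℓ∣⇔ ℓ∣b))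
  ... | _ | nonresidue _ ¬□a | _ | residue _ □b     = ⊥-elim (¬□a (Equivalence.from square⇔ □b))
  ... | _ | nonresidue _ _   | _ | nonresidue _ _   = refl

  legendre-cong : ∀ a b → a ≡ b mod ℓ → χ a ≡ χ b
  legendre-cong a b a≡b = legendre-resp-⇔
    (mk⇔ (∣-resp-≡mod (≡mod-sym a b a≡b)) (∣-resp-≡mod a≡b))
    (mk⇔ (λ (z , z²≡a) → z , ≡mod-trans (z * z) a b z²≡a a≡b)
         (λ (z , z²≡b) → z , ≡mod-trans (z * z) b a z²≡b (≡mod-sym a b a≡b)))

  legendre-*-square : ∀ m x → ¬ + ℓ ∣ℤ m → χ (m * m * x) ≡ χ x
  legendre-*-square m x ℓ∤m with inverse m ℓ∤m
  ... | s , sm≡1 = legendre-resp-⇔ (mk⇔ cancel-m² (ℤD.∣n⇒∣m*n (m * m))) (mk⇔ divide-root multiply-root)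
    where
    cancel-m² : + ℓ ∣ℤ m * m * x → + ℓ ∣ℤ x
    cancel-m² ℓ∣m²x = [ ⊥-elim ∘ ℓ∤m ∘ ℓ∣m*m⇒ℓ∣m m , id ]′ (ℓ∣m*n⇒ℓ∣m⊎ℓ∣n (m * m) x ℓ∣m²x)
    divide-root : IsSquare (m * m * x) → IsSquare x
    divide-root (z , z²≡m²x) =
      s * z , subst (+ ℓ ∣ℤ_) (rescale s z m x)
                (ℤD.∣m∣n⇒∣m+n (ℤD.∣n⇒∣m*n (s * s) z²≡m²x) (ℤD.∣m⇒∣m*n x (ℤD.∣n⇒∣m*n (s * m + + 1) sm≡1)))
      where rescale : ∀ s z m x → s * s * (z * z - m * m * x) + (s * m + + 1) * (s * m - + 1) * x
                                  ≡ s * z * (s * z) - x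
            rescale = solve-∀
    multiply-root : IsSquare x → IsSquare (m * m * x)
    multiply-root (z , z²≡x) = m * z , subst (+ ℓ ∣ℤ_) (rescale m z x) (ℤD.∣n⇒∣m*n (m * m) z²≡x)
      where rescale : ∀ m z x → m * m * (z * z - x) ≡ m * z * (m * z) - m * m * x
            rescale = solve-∀

  legendre-divisible : ∀ a → + ℓ ∣ℤ a → χ a ≡ + 0
  legendre-divisible a ℓ∣a with χ a | legendre-view a
  ... | _ | divisible _      = refl
  ... | _ | residue ℓ∤a _    = ⊥-elim (ℓ∤a ℓ∣a)
  ... | _ | nonresidue ℓ∤a _ = ⊥-elim (ℓ∤a ℓ∣a)

  legendre² : ∀ a → χ a * χ a ≡ + 1 - 𝟙 (+ ℓ ∣ℤ? a)
  legendre² a with χ a | legendre-view a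
  ... | _ | divisible ℓ∣a    = sym (cong (_-_ (+ 1)) (𝟙-yes ℓ∣a (+ ℓ ∣ℤ? a)))
  ... | _ | residue ℓ∤a _    = sym (cong (_-_ (+ 1)) (𝟙-no ℓ∤a (+ ℓ ∣ℤ? a)))
  ... | _ | nonresidue ℓ∤a _ = sym (cong (_-_ (+ 1)) (𝟙-no ℓ∤a (+ ℓ ∣ℤ? a)))

  legendre³ : ∀ a → χ a * χ a * χ a ≡ χ a
  legendre³ a with χ a | legendre-view a
  ... | _ | divisible _    = refl
  ... | _ | residue _ _    = refl
  ... | _ | nonresidue _ _ = refl

  legendre-square : ∀ c → χ (c * c) ≡ + 1 - 𝟙 (+ ℓ ∣ℤ? c)
  legendre-square c with χ (c * c) | legendre-view (c * c)
  ... | _ | divisible ℓ∣c²    = sym (cong (_-_ (+ 1)) (𝟙-yes (ℓ∣m*m⇒ℓ∣m c ℓ∣c²) (+ ℓ ∣ℤ? c)))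
  ... | _ | residue ℓ∤c² _    = sym (cong (_-_ (+ 1)) (𝟙-no (ℓ∤c² ∘ ℤD.∣m⇒∣m*n c) (+ ℓ ∣ℤ? c)))
  ... | _ | nonresidue _ ¬□c² = ⊥-elim (¬□c² (c , ℤD.divides (+ 0) (ℤP.+-inverseʳ (c * c))))

  linear-root : ∀ c b s {j₀} → s * c ≡ + 1 mod ℓ → + j₀ ≡ - (s * b) mod ℓ → + ℓ ∣ℤ c * + j₀ + b
  linear-root c b s {j₀} sc≡1 j₀≡-sb =
    subst (+ ℓ ∣ℤ_) (solution c (+ j₀) s b) (ℤD.∣m∣n⇒∣m-n (ℤD.∣n⇒∣m*n c j₀≡-sb) (ℤD.∣n⇒∣m*n b sc≡1))
    where solution : ∀ c j s b → c * (j - - (s * b)) - b * (s * c - + 1) ≡ c * j + b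
          solution = solve-∀

  linear-root-unique : ∀ c b {i j} → ¬ + ℓ ∣ℤ c → i ℕ.< ℓ → j ℕ.< ℓ →
                       + ℓ ∣ℤ c * + i + b → + ℓ ∣ℤ c * + j + b → i ≡ j
  linear-root-unique c b {i} {j} ℓ∤c i<ℓ j<ℓ ℓ∣ci+b ℓ∣cj+b =
    [ ⊥-elim ∘ ℓ∤c , ≡mod⇒≡ i<ℓ j<ℓ ]′ (ℓ∣m*n⇒ℓ∣m⊎ℓ∣n c (+ i - + j) ℓ∣c[i-j])
    where
    ℓ∣c[i-j] : + ℓ ∣ℤ c * (+ i - + j)
    ℓ∣c[i-j] = subst (+ ℓ ∣ℤ_) (difference c (+ i) (+ j) b) (ℤD.∣m∣n⇒∣m-n ℓ∣ci+b ℓ∣cj+b)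
      where difference : ∀ c i j b → c * i + b - (c * j + b) ≡ c * (i - j)
            difference = solve-∀

  linear-roots : ∀ c b → ¬ + ℓ ∣ℤ c → ∑[ j < ℓ ] 𝟙 (+ ℓ ∣ℤ? c * + j + b) ≡ + 1
  linear-roots c b ℓ∤c =
    let s , sc≡1           = inverse c ℓ∤c
        j₀ , j₀<ℓ , j₀≡-sb = ≡mod-representative ℓ (- (s * b))
        root : + ℓ ∣ℤ c * + j₀ + b
        root = linear-root c b s sc≡1 j₀≡-sb
    in trans (∑-single ℓ j₀ _ j₀<ℓ λ i i<ℓ i≢j₀ →
                𝟙-no (λ ℓ∣ci+b → i≢j₀ (linear-root-unique c b ℓ∤c i<ℓ j₀<ℓ ℓ∣ci+b root)) (+ ℓ ∣ℤ? c * + i + b))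
             (𝟙-yes root (+ ℓ ∣ℤ? c * + j₀ + b))

  #square-roots : ℤ → ℤ
  #square-roots a = ∑[ y < ℓ ] 𝟙 (+ ℓ ∣ℤ? + y * + y - a)

  square-roots-of-0 : ∀ a → + ℓ ∣ℤ a → #square-roots a ≡ + 1
  square-roots-of-0 a ℓ∣a =
    trans (∑-single ℓ 0 _ (ℕ.>-nonZero⁻¹ ℓ) λ i i<ℓ i≢0 → 𝟙-no (nonzero-no-root i<ℓ i≢0) (+ ℓ ∣ℤ? _))
          (𝟙-yes (subst (+ ℓ ∣ℤ_) (sym (ℤP.+-identityˡ (- a))) (ℤD.∣m⇒∣-m ℓ∣a)) (+ ℓ ∣ℤ? + 0 * + 0 - a))
    where
    nonzero-no-root : ∀ {i} → i ℕ.< ℓ → i ≢ 0 → ¬ + ℓ ∣ℤ + i * + i - a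
    nonzero-no-root {i} i<ℓ i≢0 ℓ∣i²-a =
      ℓ∤nonzero i<ℓ i≢0 (ℓ∣m*m⇒ℓ∣m (+ i) (∣-resp-≡mod ℓ∣i²-a ℓ∣a))

  square-roots-of-residue : ∀ a x → ¬ + ℓ ∣ℤ a → x ℕ.< ℓ → + x * + x ≡ a mod ℓ → #square-roots a ≡ + 2
  square-roots-of-residue a x ℓ∤a x<ℓ x²≡a =
    trans (∑-pair ℓ x y _ x<ℓ y<ℓ x≢y only-roots)
          (cong₂ _+_ (𝟙-yes x²≡a (+ ℓ ∣ℤ? _)) (𝟙-yes y²≡a (+ ℓ ∣ℤ? _)))
    where
    x≢0 : x ≢ 0
    x≢0 refl = ℓ∤a (subst (+ ℓ ∣ℤ_) (ℤP.neg-involutive a)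
                         (ℤD.∣m⇒∣-m (subst (+ ℓ ∣ℤ_) (ℤP.+-identityˡ (- a)) x²≡a)))
    y : ℕ
    y = ℓ ∸ x
    y<ℓ : y ℕ.< ℓ
    y<ℓ = ℕP.∸-monoʳ-< (ℕP.n≢0⇒n>0 x≢0) (ℕP.<⇒≤ x<ℓ)
    +y≡ℓ-x : + y ≡ + ℓ - + x
    +y≡ℓ-x = sym (trans (ℤP.m-n≡m⊖n ℓ x) (ℤP.⊖-≥ (ℕP.<⇒≤ x<ℓ)))
    y²≡a : + y * + y ≡ a mod ℓ
    y²≡a = subst (λ t → t * t ≡ a mod ℓ) (sym +y≡ℓ-x)
             (subst (+ ℓ ∣ℤ_) (reflect (+ x) a (+ ℓ))
                    (ℤD.∣m∣n⇒∣m+n x²≡a (ℤD.∣m⇒∣m*n (+ ℓ - + 2 * + x) ℤD.∣-refl)))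
      where reflect : ∀ x a l → x * x - a + l * (l - + 2 * x) ≡ (l - x) * (l - x) - a
            reflect = solve-∀
    x≢y : x ≢ y
    x≢y x≡y = [ ℓ∤+2 , ℓ∤nonzero x<ℓ x≢0 ]′ (ℓ∣m*n⇒ℓ∣m⊎ℓ∣n (+ 2) (+ x) ℓ∣2x)
      where
      ℓ∣2x : + ℓ ∣ℤ + 2 * + x
      ℓ∣2x = ℤD.divides (+ 1) (begin
        + 2 * + x          ≡⟨ double (+ x) ⟩
        + x + + x          ≡⟨ cong (_+_ (+ x)) (trans (cong +_ x≡y) +y≡ℓ-x) ⟩
        + x + (+ ℓ - + x)  ≡⟨ cancel (+ x) (+ ℓ) ⟩
        + 1 * + ℓ          ∎)
        where
        open ≡-Reasoning
        double : ∀ x → + 2 * x ≡ x + x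
        double = solve-∀
        cancel : ∀ x l → x + (l - x) ≡ + 1 * l
        cancel = solve-∀
    only-roots : ∀ i → i ℕ.< ℓ → i ≢ x → i ≢ y → 𝟙 (+ ℓ ∣ℤ? + i * + i - a) ≡ + 0
    only-roots i i<ℓ i≢x i≢y = 𝟙-no no-root (+ ℓ ∣ℤ? _)
      where
      no-root : ¬ + ℓ ∣ℤ + i * + i - a
      no-root ℓ∣i²-a = [ i≢x ∘ ≡mod⇒≡ i<ℓ x<ℓ , i≢y ∘ ≡mod⇒≡ i<ℓ y<ℓ ∘ i≡y ]′
                         (ℓ∣m*n⇒ℓ∣m⊎ℓ∣n (+ i - + x) (+ i + + x) factored)
        where
        factored : + ℓ ∣ℤ (+ i - + x) * (+ i + + x)
        factored = subst (+ ℓ ∣ℤ_) (factor (+ i) (+ x) a) (ℤD.∣m∣n⇒∣m-n ℓ∣i²-a x²≡a)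
          where factor : ∀ i x a → i * i - a - (x * x - a) ≡ (i - x) * (i + x)
                factor = solve-∀
        i≡y : + ℓ ∣ℤ + i + + x → + i ≡ + y mod ℓ
        i≡y ℓ∣i+x = subst (λ t → + i ≡ t mod ℓ) (sym +y≡ℓ-x)
                      (subst (+ ℓ ∣ℤ_) (shift (+ i) (+ x) (+ ℓ)) (ℤD.∣m∣n⇒∣m-n ℓ∣i+x ℤD.∣-refl))
          where shift : ∀ i x l → i + x - l ≡ i - (l - x)
                shift = solve-∀

  #square-roots-by-view : ∀ {a v} → LegendreView a v → #square-roots a ≡ + 1 + v
  #square-roots-by-view {a} (divisible ℓ∣a)     = square-roots-of-0 a ℓ∣a
  #square-roots-by-view {a} (residue ℓ∤a □a)    =
    let x , x<ℓ , x²≡a = small-square-root □a in square-roots-of-residue a x ℓ∤a x<ℓ x²≡a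
  #square-roots-by-view {a} (nonresidue _ ¬□a)  =
    ∑-zero ℓ _ λ i _ → 𝟙-no (λ i²≡a → ¬□a (+ i , i²≡a)) (+ ℓ ∣ℤ? _)

  #square-roots≡1+legendre : ∀ a → #square-roots a ≡ + 1 + χ a
  #square-roots≡1+legendre a = #square-roots-by-view (legendre-view a)

  ∑-legendre² : ∀ a → ∑[ j < ℓ ] (χ (+ j * + j - a) * χ (+ j * + j - a)) ≡ + ℓ - (+ 1 + χ a)
  ∑-legendre² a = begin
    ∑[ j < ℓ ] (χ (t j) * χ (t j))                     ≡⟨ ∑-cong ℓ _ _ (λ j _ → legendre² (t j)) ⟩
    ∑[ j < ℓ ] (+ 1 - 𝟙 (+ ℓ ∣ℤ? t j))                 ≡⟨ ∑-+ ℓ (λ _ → + 1) (λ j → - 𝟙 (+ ℓ ∣ℤ? t j)) ⟩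
    ∑[ j < ℓ ] (+ 1) + ∑[ j < ℓ ] (- 𝟙 (+ ℓ ∣ℤ? t j))  ≡⟨ cong₂ _+_ (∑-const ℓ (+ 1)) (∑-neg ℓ _) ⟩
    + ℓ * + 1 - #square-roots a                        ≡⟨ cong₂ _-_ (ℤP.*-identityʳ (+ ℓ)) (#square-roots≡1+legendre a) ⟩
    + ℓ - (+ 1 + χ a)                                  ∎
    where
    open ≡-Reasoning
    t : ℕ → ℤ
    t j = + j * + j - a

  #square-roots-shift : ∀ a j → #square-roots (+ j * + j - a) ≡ ∑[ u < ℓ ] 𝟙 (+ ℓ ∣ℤ? + 2 * + u * + j + (+ u * + u + a))
  #square-roots-shift a j = begin
    ∑< ℓ root
      ≡⟨ sym (∑-rotate ℓ root root-periodic j) ⟩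
    ∑[ u < ℓ ] root (j ℕ.+ u)
      ≡⟨ ∑-cong ℓ _ _ (λ u _ → cong (𝟙 ∘ (+ ℓ ∣ℤ?_)) (expand u)) ⟩
    ∑[ u < ℓ ] 𝟙 (+ ℓ ∣ℤ? + 2 * + u * + j + (+ u * + u + a))
      ∎
    where
    open ≡-Reasoning
    t : ℤ
    t = + j * + j - a
    root : ℕ → ℤ
    root y = 𝟙 (+ ℓ ∣ℤ? + y * + y - t)
    root-periodic : Periodic ℓ root
    root-periodic i = 𝟙-⇔ _ _ (∣-resp-≡mod (≡mod-sym (+ (ℓ ℕ.+ i) * + (ℓ ℕ.+ i) - t) (+ i * + i - t) shifted))
                                (∣-resp-≡mod shifted)
      where
      shifted : + (ℓ ℕ.+ i) * + (ℓ ℕ.+ i) - t ≡ + i * + i - t mod ℓ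
      shifted = ℤD.divides (+ ℓ + + 2 * + i) (trans (cong (λ z → z * z - t - (+ i * + i - t)) (ℤP.pos-+ ℓ i))
                                                    (square-shift (+ ℓ) (+ i) t))
        where square-shift : ∀ l i t → (l + i) * (l + i) - t - (i * i - t) ≡ (l + + 2 * i) * l
              square-shift = solve-∀
    expand : ∀ u → + (j ℕ.+ u) * + (j ℕ.+ u) - t ≡ + 2 * + u * + j + (+ u * + u + a)
    expand u = trans (cong (λ z → z * z - t) (ℤP.pos-+ j u)) (binomial (+ j) (+ u) a)
      where binomial : ∀ j u a → (j + u) * (j + u) - (j * j - a) ≡ + 2 * u * j + (u * u + a)
            binomial = solve-∀

  ∑-legendre-quadratic : ∀ a → ¬ + ℓ ∣ℤ a → ∑[ j < ℓ ] χ (+ j * + j - a) ≡ - + 1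
  ∑-legendre-quadratic a ℓ∤a = begin
    ∑[ j < ℓ ] χ (+ j * + j - a)                      ≡⟨ ∑-cong ℓ _ _ (λ j _ → legendre-via-roots j) ⟩
    ∑[ j < ℓ ] (∑[ u < ℓ ] F j u + - + 1)             ≡⟨ ∑-+ ℓ (λ j → ∑[ u < ℓ ] F j u) (λ _ → - + 1) ⟩
    ∑[ j < ℓ ] ∑[ u < ℓ ] F j u + ∑[ j < ℓ ] (- + 1)  ≡⟨ cong₂ _+_ (∑-swap ℓ ℓ F) (∑-const ℓ (- + 1)) ⟩
    ∑[ u < ℓ ] ∑[ j < ℓ ] F j u + + ℓ * - + 1         ≡⟨ cong (_+ + ℓ * - + 1) (∑-head ℓ _) ⟩
    ∑[ j < ℓ ] F j 0 + ∑[ u < ℕ.pred ℓ ] ∑[ j < ℓ ] F j (suc u) + + ℓ * - + 1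
        ≡⟨ cong (_+ + ℓ * - + 1) (cong₂ _+_ column-0 columns-suc) ⟩
    + 0 + + ℕ.pred ℓ * + 1 + + ℓ * - + 1
        ≡⟨ cong (λ l → + 0 + + ℕ.pred ℓ * + 1 + + l * - + 1) (sym (ℕP.suc-pred ℓ)) ⟩
    + 0 + + ℕ.pred ℓ * + 1 + + suc (ℕ.pred ℓ) * - + 1  ≡⟨ arithmetic (+ ℕ.pred ℓ) ⟩
    - + 1                                              ∎
    where
    open ≡-Reasoning
    F : ℕ → ℕ → ℤ
    F j u = 𝟙 (+ ℓ ∣ℤ? + 2 * + u * + j + (+ u * + u + a))
    legendre-via-roots : ∀ j → χ (+ j * + j - a) ≡ ∑[ u < ℓ ] F j u + - + 1
    legendre-via-roots j = begin
      χ (+ j * + j - a)                      ≡⟨ sym (cancel (χ (+ j * + j - a))) ⟩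
      + 1 + χ (+ j * + j - a) + - + 1        ≡⟨ cong (_+ - + 1) (sym (#square-roots≡1+legendre _)) ⟩
      #square-roots (+ j * + j - a) + - + 1  ≡⟨ cong (_+ - + 1) (#square-roots-shift a j) ⟩
      ∑[ u < ℓ ] F j u + - + 1               ∎
      where cancel : ∀ x → + 1 + x + - + 1 ≡ x
            cancel = solve-∀
    column-0 : ∑[ j < ℓ ] F j 0 ≡ + 0
    column-0 = ∑-zero ℓ _ λ j _ → 𝟙-no (ℓ∤a ∘ subst (+ ℓ ∣ℤ_) (constant-term (+ j) a)) (+ ℓ ∣ℤ? _)
      where constant-term : ∀ j a → + 2 * + 0 * j + (+ 0 * + 0 + a) ≡ a
            constant-term = solve-∀
    column-suc : ∀ u → u ℕ.< ℕ.pred ℓ → ∑[ j < ℓ ] F j (suc u) ≡ + 1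
    column-suc u u<ℓ-1 = linear-roots (+ 2 * + suc u) (+ suc u * + suc u + a)
      (ℓ∤m*n ℓ∤+2 (ℓ∤nonzero (subst (suc (suc u) ℕ.≤_) (ℕP.suc-pred ℓ) (s≤s u<ℓ-1)) λ ()))
    columns-suc : ∑[ u < ℕ.pred ℓ ] ∑[ j < ℓ ] F j (suc u) ≡ + ℕ.pred ℓ * + 1
    columns-suc = trans (∑-cong (ℕ.pred ℓ) _ _ column-suc) (∑-const (ℕ.pred ℓ) (+ 1))
    arithmetic : ∀ p → + 0 + p * + 1 + (+ 1 + p) * - + 1 ≡ - + 1
    arithmetic = solve-∀

  coprime-ℓ^ : ∀ {x} e → ¬ + ℓ ∣ℤ + x → Coprime x (ℓ ℕ.^ e)
  coprime-ℓ^ zero    ℓ∤x (_ , d∣1) = ℕD.∣1⇒≡1 d∣1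
  coprime-ℓ^ (suc e) ℓ∤x {d} (d∣x , d∣ℓ^suc-e) =
    coprime-ℓ^ e ℓ∤x (d∣x , coprime-divisor d⊥ℓ d∣ℓ^suc-e)
    where d⊥ℓ : Coprime d ℓ
          d⊥ℓ = ℓ∤⇒coprime λ ℓ∣d → ℓ∤x (ℤD.∣-trans ℓ∣d (∣ᵤ⇒∣ d∣x))

  gcd-ℓ^≡1⇔ℓ∤ : ∀ x e → gcd x (ℓ ℕ.^ suc e) ≡ 1 ⇔ (¬ + ℓ ∣ℤ + x)
  gcd-ℓ^≡1⇔ℓ∤ x e = mk⇔ to (coprime⇒gcd≡1 ∘ coprime-ℓ^ (suc e))
    where
    to : gcd x (ℓ ℕ.^ suc e) ≡ 1 → ¬ + ℓ ∣ℤ + x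
    to gcd≡1 ℓ∣x = ℓ∤1 (∣ᵤ⇒∣ (subst (ℓ ∣_) gcd≡1 (gcd-greatest (∣⇒∣ᵤ ℓ∣x) (ℕD.m∣m*n (ℓ ℕ.^ e)))))

  module Trace (m k w′ : ℕ) where

    w N : ℕ
    w = suc w′
    N = m ℕ.* m ℕ.* k

    instance
      ℓ^w-nonZero : ℕ.NonZero (ℓ ℕ.^ w)
      ℓ^w-nonZero = ℕP.m^n≢0 ℓ w

    discriminant : ℕ → ℤ
    discriminant j = + j * + j - + (4 ℕ.* k)

    gcd-term : ℕ → ℕ
    gcd-term j = N ℕ.+ 1 ℕ.+ j ℕ.* m

    weight : ℕ → ℤ
    weight j = χ (discriminant j) ^ w

    excluded : ℕ → ℤ
    excluded j = 𝟙 (+ ℓ ∣ℤ? + gcd-term j)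

    sq : ℤ
    sq = χ (+ m * (+ N - + 1)) ^ 2

    summand : ℕ → ℤ
    summand j = weight j * (+ 1 - excluded j)

    n : ℕ
    n = ℓ ℕ.^ w

    jacobi : ℤ → ℤ
    jacobi a = χ (a - + (4 ℕ.* k)) ^ w

    square-test : ∀ j d → Dec (n ∣ ∣ + (j ℕ.* j) - + d ∣)
    square-test j d = n ∣? ∣ + (j ℕ.* j) - + d ∣

    coprime-test : ∀ j → Dec (gcd (gcd-term j) n ≡ 1)
    coprime-test j = gcd (gcd-term j) n ℕ.≟ 1

    jacobi-resp : ∀ a b → a ≡ b mod n → jacobi a ≡ jacobi b
    jacobi-resp a b a≡b =
      cong (_^ w) (legendre-cong _ _ (subst (+ ℓ ∣ℤ_) (shift a b (+ (4 ℕ.* k))) (ℤD.∣-trans ℓ∣n a≡b)))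
      where
      ℓ∣n : + ℓ ∣ℤ + n
      ℓ∣n = ∣ᵤ⇒∣ (ℕD.m∣m*n (ℓ ℕ.^ w′))
      shift : ∀ a b c → a - b ≡ a - c - (b - c)
      shift = solve-∀

    coprime-indicator : ∀ j → 𝟙 (coprime-test j) ≡ + 1 - excluded j
    coprime-indicator j = trans (𝟙-⇔ (coprime-test j) (¬? (+ ℓ ∣ℤ? + gcd-term j)) to from) (𝟙-¬ (+ ℓ ∣ℤ? + gcd-term j))
      where
      to : gcd (gcd-term j) n ≡ 1 → ¬ + ℓ ∣ℤ + gcd-term j
      to = Equivalence.to (gcd-ℓ^≡1⇔ℓ∤ (gcd-term j) w′)
      from : ¬ + ℓ ∣ℤ + gcd-term j → gcd (gcd-term j) n ≡ 1
      from = Equivalence.from (gcd-ℓ^≡1⇔ℓ∤ (gcd-term j) w′)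

    ∑-over-d : ∀ j → ∑[ d < n ] (jacobi (+ d) * (𝟙 (square-test j d) * 𝟙 (coprime-test j))) ≡ summand j
    ∑-over-d j = begin
      ∑[ d < n ] (jacobi (+ d) * (𝟙 (P d) * 𝟙 Q))  ≡⟨ ∑-cong n _ _ (λ d _ → reorder (jacobi (+ d)) (𝟙 (P d)) (𝟙 Q)) ⟩
      ∑[ d < n ] (𝟙 Q * (jacobi (+ d) * 𝟙 (P d)))  ≡⟨ ∑-*ˡ n (𝟙 Q) _ ⟩
      𝟙 Q * ∑[ d < n ] (jacobi (+ d) * 𝟙 (P d))
        ≡⟨ cong₂ _*_ (coprime-indicator j) (∑-select-mod n jacobi jacobi-resp (+ (j ℕ.* j))) ⟩
      (+ 1 - excluded j) * jacobi (+ (j ℕ.* j))    ≡⟨ ℤP.*-comm (+ 1 - excluded j) _ ⟩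
      jacobi (+ (j ℕ.* j)) * (+ 1 - excluded j)    ≡⟨ cong (λ z → jacobi z * (+ 1 - excluded j)) (ℤP.pos-* j j) ⟩
      summand j                                    ∎
      where
      open ≡-Reasoning
      P : ∀ d → Dec (n ∣ ∣ + (j ℕ.* j) - + d ∣)
      P = square-test j
      Q : Dec (gcd (gcd-term j) n ≡ 1)
      Q = coprime-test j
      reorder : ∀ a b c → a * (b * c) ≡ c * (a * b)
      reorder = solve-∀

    T-as-∑ : T ℓ w m k ≡ ∑< n summand
    T-as-∑ = begin
      T ℓ w m k
        ≡⟨ sumℤ-map-applyUpTo (λ d → jacobi (+ d) * + count n N m d) id n ⟩
      ∑[ d < n ] (jacobi (+ d) * + count n N m d)
        ≡⟨ ∑-cong n _ _ (λ d _ → cong (jacobi (+ d) *_) (count-as-∑ d)) ⟩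
      ∑[ d < n ] (jacobi (+ d) * ∑[ j < n ] (𝟙 (square-test j d) * 𝟙 (coprime-test j)))
        ≡⟨ ∑-cong n _ _ (λ d _ → sym (∑-*ˡ n (jacobi (+ d)) _)) ⟩
      ∑[ d < n ] ∑[ j < n ] (jacobi (+ d) * (𝟙 (square-test j d) * 𝟙 (coprime-test j)))
        ≡⟨ ∑-swap n n _ ⟩
      ∑[ j < n ] ∑[ d < n ] (jacobi (+ d) * (𝟙 (square-test j d) * 𝟙 (coprime-test j)))
        ≡⟨ ∑-cong n _ _ (λ j _ → ∑-over-d j) ⟩
      ∑< n summand
        ∎
      where
      open ≡-Reasoning
      count-as-∑ : ∀ d → + count n N m d ≡ ∑[ j < n ] (𝟙 (square-test j d) * 𝟙 (coprime-test j))
      count-as-∑ d = trans (length-filter (λ j → square-test j d ×-dec coprime-test j) id n)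
                           (∑-cong n _ _ (λ j _ → 𝟙-× (square-test j d) (coprime-test j)))

    +N : + N ≡ + m * + m * + k
    +N = trans (ℤP.pos-* (m ℕ.* m) k) (cong (_* + k) (ℤP.pos-* m m))

    +gcd-term : ∀ j → + gcd-term j ≡ + m * + j + + (N ℕ.+ 1)
    +gcd-term j = begin
      + (N ℕ.+ 1) + + (j ℕ.* m)  ≡⟨ ℤP.+-comm (+ (N ℕ.+ 1)) (+ (j ℕ.* m)) ⟩
      + (j ℕ.* m) + + (N ℕ.+ 1)  ≡⟨ cong (_+ + (N ℕ.+ 1)) (trans (ℤP.pos-* j m) (ℤP.*-comm (+ j) (+ m))) ⟩
      + m * + j + + (N ℕ.+ 1)    ∎
      where open ≡-Reasoning

    +gcd-term-expanded : ∀ j → + gcd-term j ≡ + m * + j + (+ m * + m * + k + + 1)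
    +gcd-term-expanded j = trans (+gcd-term j) (cong (λ c → + m * + j + (c + + 1)) +N)

    summand-periodic : Periodic ℓ summand
    summand-periodic i = cong₂ (λ x e → x * (+ 1 - e)) weight-periodic excluded-periodic
      where
      weight-periodic : weight (ℓ ℕ.+ i) ≡ weight i
      weight-periodic = cong (_^ w) (legendre-cong _ _ (ℤD.divides (+ ℓ + + 2 * + i)
        (trans (cong (λ z → z * z - + (4 ℕ.* k) - discriminant i) (ℤP.pos-+ ℓ i)) (square-shift (+ ℓ) (+ i) (+ (4 ℕ.* k))))))
        where square-shift : ∀ l i c → (l + i) * (l + i) - c - (i * i - c) ≡ (l + + 2 * i) * l
              square-shift = solve-∀
      excluded-periodic : excluded (ℓ ℕ.+ i) ≡ excluded i
      excluded-periodic =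
        𝟙-⇔ _ _ (∣-resp-≡mod (≡mod-sym (+ gcd-term (ℓ ℕ.+ i)) (+ gcd-term i) gcd-term-shift)) (∣-resp-≡mod gcd-term-shift)
        where
        gcd-term-shift : + gcd-term (ℓ ℕ.+ i) ≡ + gcd-term i mod ℓ
        gcd-term-shift = ℤD.divides (+ m) (begin
          + gcd-term (ℓ ℕ.+ i) - + gcd-term i                     ≡⟨ cong₂ _-_ (+gcd-term (ℓ ℕ.+ i)) (+gcd-term i) ⟩
          + m * + (ℓ ℕ.+ i) + + (N ℕ.+ 1) - (+ m * + i + + (N ℕ.+ 1))
            ≡⟨ cong (λ z → + m * z + + (N ℕ.+ 1) - (+ m * + i + + (N ℕ.+ 1))) (ℤP.pos-+ ℓ i) ⟩
          + m * (+ ℓ + + i) + + (N ℕ.+ 1) - (+ m * + i + + (N ℕ.+ 1)) ≡⟨ cancel (+ m) (+ ℓ) (+ i) (+ (N ℕ.+ 1)) ⟩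
          + m * + ℓ                                               ∎)
          where
          open ≡-Reasoning
          cancel : ∀ m l i c → m * (l + i) + c - (m * i + c) ≡ m * l
          cancel = solve-∀

    T≡ℓ^w′*∑ : T ℓ w m k ≡ + (ℓ ℕ.^ w′) * ∑< ℓ summand
    T≡ℓ^w′*∑ = trans T-as-∑ (trans (cong (λ q → ∑< q summand) (ℕP.*-comm ℓ (ℓ ℕ.^ w′)))
                                   (∑-periodic (ℓ ℕ.^ w′) ℓ summand summand-periodic))

    ℓ∤m-if-excluded : ∀ j → + ℓ ∣ℤ + gcd-term j → ¬ + ℓ ∣ℤ + m
    ℓ∤m-if-excluded j ℓ∣gcd-term ℓ∣m =
      ℓ∤1 (subst (+ ℓ ∣ℤ_) (unit (+ m) (+ j) (+ k))
             (ℤD.∣m∣n⇒∣m-n (subst (+ ℓ ∣ℤ_) (+gcd-term-expanded j) ℓ∣gcd-term) (ℤD.∣m⇒∣m*n (+ j + + m * + k) ℓ∣m)))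
      where unit : ∀ m j k → m * j + (m * m * k + + 1) - m * (j + m * k) ≡ + 1
            unit = solve-∀

    discriminant-if-excluded : ∀ j → + ℓ ∣ℤ + gcd-term j →
                               + m * + m * discriminant j ≡ (+ N - + 1) * (+ N - + 1) mod ℓ
    discriminant-if-excluded j ℓ∣gcd-term =
      subst (+ ℓ ∣ℤ_) (sym difference) (ℤD.∣n⇒∣m*n (+ m * + j - (+ m * + m * + k + + 1)) ℓ∣gcd-term)
      where
      open ≡-Reasoning
      factor : ∀ m j k → m * m * (j * j - + 4 * k) - (m * m * k - + 1) * (m * m * k - + 1)
                         ≡ (m * j - (m * m * k + + 1)) * (m * j + (m * m * k + + 1))
      factor = solve-∀
      difference : + m * + m * discriminant j - (+ N - + 1) * (+ N - + 1)
                   ≡ (+ m * + j - (+ m * + m * + k + + 1)) * + gcd-term j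
      difference = begin
        + m * + m * (+ j * + j - + (4 ℕ.* k)) - (+ N - + 1) * (+ N - + 1)
          ≡⟨ cong₂ (λ c n → + m * + m * (+ j * + j - c) - (n - + 1) * (n - + 1)) (ℤP.pos-* 4 k) +N ⟩
        + m * + m * (+ j * + j - + 4 * + k) - (+ m * + m * + k - + 1) * (+ m * + m * + k - + 1)
          ≡⟨ factor (+ m) (+ j) (+ k) ⟩
        (+ m * + j - (+ m * + m * + k + + 1)) * (+ m * + j + (+ m * + m * + k + + 1))
          ≡⟨ cong ((+ m * + j - (+ m * + m * + k + + 1)) *_) (sym (+gcd-term-expanded j)) ⟩
        (+ m * + j - (+ m * + m * + k + + 1)) * + gcd-term j
          ∎

    weight-if-excluded : ∀ j → + ℓ ∣ℤ + gcd-term j → weight j ≡ sq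
    weight-if-excluded j ℓ∣gcd-term = begin
      χ (discriminant j) ^ w                         ≡⟨ cong (_^ w) (sym (legendre-*-square (+ m) (discriminant j) ℓ∤m)) ⟩
      χ (+ m * + m * discriminant j) ^ w             ≡⟨ cong (_^ w) (legendre-cong _ _ (discriminant-if-excluded j ℓ∣gcd-term)) ⟩
      χ ((+ N - + 1) * (+ N - + 1)) ^ w              ≡⟨ cong (_^ w) (legendre-square (+ N - + 1)) ⟩
      (+ 1 - 𝟙 (+ ℓ ∣ℤ? + N - + 1)) ^ w              ≡⟨ ^-idempotent (𝟙-complement-idempotent (+ ℓ ∣ℤ? _)) w′ ⟩
      + 1 - 𝟙 (+ ℓ ∣ℤ? + N - + 1)                    ≡⟨ cong (_-_ (+ 1)) cancel-m-indicator ⟩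
      + 1 - 𝟙 (+ ℓ ∣ℤ? + m * (+ N - + 1))            ≡⟨ sym (legendre² (+ m * (+ N - + 1))) ⟩
      χ (+ m * (+ N - + 1)) * χ (+ m * (+ N - + 1))  ≡⟨ cong (χ (+ m * (+ N - + 1)) *_) (sym (ℤP.*-identityʳ _)) ⟩
      sq                                             ∎
      where
      open ≡-Reasoning
      ℓ∤m : ¬ + ℓ ∣ℤ + m
      ℓ∤m = ℓ∤m-if-excluded j ℓ∣gcd-term
      cancel-m : + ℓ ∣ℤ + m * (+ N - + 1) → + ℓ ∣ℤ + N - + 1
      cancel-m ℓ∣m[N-1] = [ ⊥-elim ∘ ℓ∤m , id ]′ (ℓ∣m*n⇒ℓ∣m⊎ℓ∣n (+ m) _ ℓ∣m[N-1])
      cancel-m-indicator : 𝟙 (+ ℓ ∣ℤ? + N - + 1) ≡ 𝟙 (+ ℓ ∣ℤ? + m * (+ N - + 1))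
      cancel-m-indicator = 𝟙-⇔ _ _ (ℤD.∣n⇒∣m*n (+ m)) cancel-m

    sq*∑-excluded≡sq : Dec (+ ℓ ∣ℤ + m) → sq * ∑< ℓ excluded ≡ sq
    sq*∑-excluded≡sq (yes ℓ∣m) = trans (cong (λ z → z ^ 2 * ∑< ℓ excluded) χ≡0) (sym (cong (_^ 2) χ≡0))
      where χ≡0 : χ (+ m * (+ N - + 1)) ≡ + 0
            χ≡0 = legendre-divisible _ (ℤD.∣m⇒∣m*n (+ N - + 1) ℓ∣m)
    sq*∑-excluded≡sq (no ℓ∤m) = trans (cong (sq *_) ∑-excluded≡1) (ℤP.*-identityʳ sq)
      where
      ∑-excluded≡1 : ∑< ℓ excluded ≡ + 1
      ∑-excluded≡1 = trans (∑-cong ℓ _ _ λ j _ → cong (𝟙 ∘ (+ ℓ ∣ℤ?_)) (+gcd-term j))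
                           (linear-roots (+ m) (+ (N ℕ.+ 1)) ℓ∤m)

    T≡ℓ^w′*[∑-weight-sq] : T ℓ w m k ≡ + (ℓ ℕ.^ w′) * (∑< ℓ weight - sq)
    T≡ℓ^w′*[∑-weight-sq] = trans T≡ℓ^w′*∑ (cong (+ (ℓ ℕ.^ w′) *_) (begin
      ∑< ℓ summand                                          ≡⟨ ∑-cong ℓ _ _ (λ j _ → distribute (weight j) (excluded j)) ⟩
      ∑[ j < ℓ ] (weight j + - (weight j * excluded j))     ≡⟨ ∑-+ ℓ weight _ ⟩
      ∑< ℓ weight + ∑[ j < ℓ ] (- (weight j * excluded j))  ≡⟨ cong (_+_ (∑< ℓ weight)) (∑-neg ℓ _) ⟩
      ∑< ℓ weight - ∑[ j < ℓ ] (weight j * excluded j)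
        ≡⟨ cong (_-_ (∑< ℓ weight)) (∑-cong ℓ _ _ λ j _ → *-𝟙-cong (+ ℓ ∣ℤ? _) (weight-if-excluded j)) ⟩
      ∑< ℓ weight - ∑[ j < ℓ ] (sq * excluded j)
        ≡⟨ cong (_-_ (∑< ℓ weight)) (trans (∑-*ˡ ℓ sq excluded) (sq*∑-excluded≡sq (+ ℓ ∣ℤ? + m))) ⟩
      ∑< ℓ weight - sq
        ∎))
      where
      open ≡-Reasoning
      distribute : ∀ x e → x * (+ 1 - e) ≡ x + - (x * e)
      distribute = solve-∀

    ∑-weight-even : 2 ∣ w → ∑< ℓ weight ≡ + ℓ - (+ 1 + χ (+ k))
    ∑-weight-even (divides (suc q) w≡[1+q]*2) = begin
      ∑< ℓ weight                                           ≡⟨ ∑-cong ℓ _ _ (λ j _ → even-power j) ⟩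
      ∑[ j < ℓ ] (χ (discriminant j) * χ (discriminant j))  ≡⟨ ∑-legendre² (+ (4 ℕ.* k)) ⟩
      + ℓ - (+ 1 + χ (+ (4 ℕ.* k)))                         ≡⟨ cong (λ z → + ℓ - (+ 1 + z)) χ4k≡χk ⟩
      + ℓ - (+ 1 + χ (+ k))                                 ∎
      where
      open ≡-Reasoning
      even-power : ∀ j → weight j ≡ χ (discriminant j) * χ (discriminant j)
      even-power j = trans (cong (χ (discriminant j) ^_) w≡[1+q]*2) (^-even-of-cube (legendre³ _) q)
      χ4k≡χk : χ (+ (4 ℕ.* k)) ≡ χ (+ k)
      χ4k≡χk = trans (cong χ (ℤP.pos-* 4 k)) (legendre-*-square (+ 2) (+ k) ℓ∤+2)

    ∑-weight-odd : ¬ 2 ∣ w → ¬ + ℓ ∣ℤ + k → ∑< ℓ weight ≡ - + 1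
    ∑-weight-odd 2∤w ℓ∤k = trans (∑-cong ℓ _ _ odd-power) (∑-legendre-quadratic (+ (4 ℕ.* k)) ℓ∤4k)
      where
      odd-power : ∀ j → j ℕ.< ℓ → weight j ≡ χ (discriminant j)
      odd-power j _ = let q , w≡1+q*2 = odd⇒suc-*2 w 2∤w in
        trans (cong (χ (discriminant j) ^_) w≡1+q*2) (^-odd-of-cube (legendre³ _) q)
      ℓ∤4k : ¬ + ℓ ∣ℤ + (4 ℕ.* k)
      ℓ∤4k = ℓ∤m*n (ℓ∤m*n ℓ∤+2 ℓ∤+2) ℓ∤k ∘ subst (+ ℓ ∣ℤ_) (ℤP.pos-* 4 k)

proposition5p2 : (m k ℓ w : ℕ) → m ≥ 1 → k ≥ 1 → Prime ℓ → ¬ (ℓ ∣ 2 ℕ.* k) → w ≥ 1 →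
    let N = m ℕ.* m ℕ.* k
        sq = legendre ℓ ((+ m) ℤ.* ((+ N) ℤ.- (+ 1))) ℤ.^ 2
    in ((2 ∣ w) → T ℓ w m k ≡ (+ (ℓ ℕ.^ (w ∸ 1))) ℤ.* (ℤ.- sq ℤ.+ ((+ ℓ) ℤ.- (+ 1) ℤ.- legendre ℓ (+ k))))
     × ((¬ (2 ∣ w)) → T ℓ w m k ≡ (+ (ℓ ℕ.^ (w ∸ 1))) ℤ.* (ℤ.- sq ℤ.- (+ 1)))
proposition5p2 m k ℓ (suc w′) _ _ ℓ-prime ℓ∤2k _ = even , odd
  where
  open OddPrime ℓ-prime (λ ℓ∣2 → ℓ∤2k (ℕD.∣-trans ℓ∣2 (ℕD.m∣m*n k)))
  open Trace m k w′
  open ≡-Reasoning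
  ℓ∤k : ¬ + ℓ ∣ℤ + k
  ℓ∤k ℓ∣k = ℓ∤2k (ℕD.∣-trans (∣⇒∣ᵤ ℓ∣k) (ℕD.n∣m*n 2))
  even : 2 ∣ w → T ℓ w m k ≡ + (ℓ ℕ.^ w′) * (- sq + (+ ℓ - + 1 - χ (+ k)))
  even 2∣w = begin
    T ℓ w m k                                    ≡⟨ T≡ℓ^w′*[∑-weight-sq] ⟩
    + (ℓ ℕ.^ w′) * (∑< ℓ weight - sq)            ≡⟨ cong (λ s → + (ℓ ℕ.^ w′) * (s - sq)) (∑-weight-even 2∣w) ⟩
    + (ℓ ℕ.^ w′) * (+ ℓ - (+ 1 + χ (+ k)) - sq)  ≡⟨ rearrange (+ (ℓ ℕ.^ w′)) (+ ℓ) (χ (+ k)) sq ⟩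
    + (ℓ ℕ.^ w′) * (- sq + (+ ℓ - + 1 - χ (+ k)))
      ∎
    where rearrange : ∀ a l c s → a * (l - (+ 1 + c) - s) ≡ a * (- s + (l - + 1 - c))
          rearrange = solve-∀
  odd : ¬ 2 ∣ w → T ℓ w m k ≡ + (ℓ ℕ.^ w′) * (- sq - + 1)
  odd 2∤w = begin
    T ℓ w m k                          ≡⟨ T≡ℓ^w′*[∑-weight-sq] ⟩
    + (ℓ ℕ.^ w′) * (∑< ℓ weight - sq)  ≡⟨ cong (λ s → + (ℓ ℕ.^ w′) * (s - sq)) (∑-weight-odd 2∤w ℓ∤k) ⟩
    + (ℓ ℕ.^ w′) * (- + 1 - sq)        ≡⟨ cong (+ (ℓ ℕ.^ w′) *_) (ℤP.+-comm (- + 1) (- sq)) ⟩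
    + (ℓ ℕ.^ w′) * (- sq - + 1)        ∎
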